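{- Let $q$ be a prime power, let $\ell$ be a line of $\mathrm{PG}(2,q)$, $P\in\ell$, and let $\alpha:\mathcal{X}_{P,\ell}\to\mathcal{Y}_{\Pi_P}$ be the bijection $\alpha(\mathcal{B})=\mathcal{B}\setminus\{P\}$. Let $\mathcal{Z}_{P,\ell}$ be the set of all blocking semiovals of $\mathrm{PG}(2,q)$ which contain $P$ and for which $\ell$ is the unique tangent through $P$, and let $\mathcal{W}_{P,\ell}$ be the set of all blocking sets of $\mathrm{AG}(2,q)=\mathrm{PG}(2,q)\setminus\ell$ having the $\Pi$-strong property with respect to the direction $\Pi_P$. Then $\alpha(\mathcal{Z}_{P,\ell})=\mathcal{W}_{P,\ell}$.
   Context: A blocking set of $\mathrm{PG}(2,q)$ is a set of points meeting every line and containing no line; minimal if no proper subset is a blocking set. A line is tangent to a point set $\mathcal{K}$ if it meets $\mathcal{K}$ in exactly one point, secant if in more than one. A semioval is a point set $\mathcal{K}$ such that through each point of $\mathcal{K}$ there is exactly one tangent to $\mathcal{K}$; a blocking semioval is a blocking set that is a semioval. $\mathcal{B}$ has the $r_\infty$-property with respect to $P\in\mathcal{B}$ if exactly one line through $P$ is tangent to $\mathcal{B}$ and all other lines through $P$ are secants. $\mathrm{AG}(2,q)=\mathrm{PG}(2,q)\setminus\ell$ has as points those not on $\ell$ and as lines those other than $\ell$. A blocking set of $\mathrm{AG}(2,q)$ meets every affine line; minimal if no proper subset is. For $P\in\ell$, $\Pi_P$ is the set of affine lines whose projective closure passes through $P$. An affine blocking set $\mathcal{B}$ has the $\Pi$-property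 w.r.t. a direction $\Pi$ if (j) through every $Q\in\mathcal{B}$ there is an affine line $m\notin\Pi$ tangent to $\mathcal{B}$, and (jj) no line of $\Pi$ is contained in $\mathcal{B}$; it has the $\Pi$-strong property if (jj) holds and (j') through every $Q\in\mathcal{B}$ there is exactly one affine line $m\notin\Pi$ tangent to $\mathcal{B}$. $\mathcal{X}_{P,\ell}$ is the set of minimal blocking sets of $\mathrm{PG}(2,q)$ containing $P$ with the $r_\infty$-property w.r.t. $P$ and unique tangent $\ell$ at $P$; $\mathcal{Y}_{\Pi_P}$ is the set of minimal blocking sets of $\mathrm{AG}(2,q)$ with the $\Pi$-property w.r.t. $\Pi_P$. -}

module Defs where

open import Level using (0ℓ)
open import Data.Nat using (ℕ; _^_; _≥_)
open import Data.Nat.Primality using (Prime)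
open import Data.Fin using (Fin)
open import Data.Bool using (Bool; true; false; _∧_; not)
open import Data.Product using (Σ; ∃; ∃-syntax; _×_; _,_)
open import Relation.Nullary using (¬_; Dec; yes; no; does)
open import Relation.Binary.PropositionalEquality using (_≡_; _≢_; refl; cong; cong₂)
open import Relation.Binary using (DecidableEquality)
open import Algebra.Structures using (IsCommutativeRing)
open import Function.Bundles using (_↔_)

PrimePower : ℕ → Set
PrimePower q = Σ ℕ λ p → Σ ℕ λ n → Prime p × n ≥ 1 × q ≡ p ^ n

record FiniteField (q : ℕ) : Set₁ where
  field
    Carrier : Set
    _+_ _*_ : Carrier → Carrier → Carrier
    -_ : Carrier → Carrier
    0# 1# : Carrier
    isCommutativeRing : IsCommutativeRing _≡_ _+_ _*_ -_ 0# 1#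
    0≢1 : 0# ≢ 1#
    inverse : ∀ x → x ≢ 0# → ∃[ y ] (x * y ≡ 1#)
    _≟_ : DecidableEquality Carrier
    size : Carrier ↔ Fin q

module Plane {q : ℕ} (F : FiniteField q) where
  open FiniteField F

  -- Points of PG(2,q) in normalised homogeneous coordinates:
  -- (1,a,b), (0,1,a), (0,0,1).
  data Point : Set where
    pt₁ : Carrier → Carrier → Point
    pt₂ : Carrier → Point
    pt₃ : Point

  -- Lines of PG(2,q): normalised coordinate triples [u,v,w], same shapes.
  data Line : Set where
    ln₁ : Carrier → Carrier → Line
    ln₂ : Carrier → Line
    ln₃ : Line

  coords : Point → Carrier × Carrier × Carrier
  coords (pt₁ a b) = 1# , a , b
  coords (pt₂ a) = 0# , 1# , a
  coords pt₃ = 0# , 0# , 1#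

  lcoords : Line → Carrier × Carrier × Carrier
  lcoords (ln₁ a b) = 1# , a , b
  lcoords (ln₂ a) = 0# , 1# , a
  lcoords ln₃ = 0# , 0# , 1#

  _∈ₗ_ : Point → Line → Set
  p ∈ₗ L with coords p | lcoords L
  ... | (x , y , z) | (u , v , w) = ((u * x) + (v * y)) + (w * z) ≡ 0#

  _≟ₚ_ : DecidableEquality Point
  pt₁ a b ≟ₚ pt₁ c d with a ≟ c | b ≟ d
  ... | yes refl | yes refl = yes refl
  ... | no ne | _ = no λ { refl → ne refl }
  ... | yes _ | no ne = no λ { refl → ne refl }
  pt₁ _ _ ≟ₚ pt₂ _ = no λ ()
  pt₁ _ _ ≟ₚ pt₃ = no λ ()
  pt₂ _ ≟ₚ pt₁ _ _ = no λ ()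
  pt₂ a ≟ₚ pt₂ c with a ≟ c
  ... | yes refl = yes refl
  ... | no ne = no λ { refl → ne refl }
  pt₂ _ ≟ₚ pt₃ = no λ ()
  pt₃ ≟ₚ pt₁ _ _ = no λ ()
  pt₃ ≟ₚ pt₂ _ = no λ ()
  pt₃ ≟ₚ pt₃ = yes refl

  PointSet : Set
  PointSet = Point → Bool

  _∈_ : Point → PointSet → Set
  x ∈ K = K x ≡ true

  _⊆_ : PointSet → PointSet → Set
  K ⊆ K′ = ∀ x → x ∈ K → x ∈ K′

  _∖｛_｝ : PointSet → Point → PointSet
  (K ∖｛ P ｝) x = K x ∧ not (does (x ≟ₚ P))

  Meets : PointSet → Line → Set
  Meets K L = ∃[ x ] (x ∈ K × x ∈ₗ L)

  Tangent : PointSet → Line → Set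
  Tangent K L = ∃[ x ] (x ∈ K × x ∈ₗ L × (∀ y → y ∈ K → y ∈ₗ L → y ≡ x))

  Secant : PointSet → Line → Set
  Secant K L = ∃[ x ] ∃[ y ] (x ≢ y × x ∈ K × x ∈ₗ L × y ∈ K × y ∈ₗ L)

  ContainsLine : PointSet → Line → Set
  ContainsLine K L = ∀ x → x ∈ₗ L → x ∈ K

  BlockingSet : PointSet → Set
  BlockingSet K = (∀ L → Meets K L) × (∀ L → ¬ ContainsLine K L)

  MinimalBlockingSet : PointSet → Set
  MinimalBlockingSet K =
    BlockingSet K × (∀ K′ → K′ ⊆ K → BlockingSet K′ → K ⊆ K′)

  Semioval : PointSet → Set
  Semioval K = ∀ x → x ∈ K →
    ∃[ L ] (x ∈ₗ L × Tangent K L × (∀ L′ → x ∈ₗ L′ → Tangent K L′ → L′ ≡ L))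

  BlockingSemioval : PointSet → Set
  BlockingSemioval K = BlockingSet K × Semioval K

  InZ : Point → Line → PointSet → Set
  InZ P ℓ K = BlockingSemioval K × P ∈ K × Tangent K ℓ
            × (∀ L → P ∈ₗ L → Tangent K L → L ≡ ℓ)

  module Affine (ℓ : Line) where

    AffineSet : PointSet → Set
    AffineSet A = ∀ x → x ∈ A → ¬ (x ∈ₗ ℓ)

    -- affine lines are the lines other than ℓ
    AffineBlockingSet : PointSet → Set
    AffineBlockingSet A = AffineSet A × (∀ m → m ≢ ℓ → Meets A m)

    ContainsAffineLine : PointSet → Line → Set
    ContainsAffineLine A m = ∀ x → x ∈ₗ m → ¬ (x ∈ₗ ℓ) → x ∈ A

    InΠ : Point → Line → Set
    InΠ P m = m ≢ ℓ × P ∈ₗ m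

    PiStrong : Point → PointSet → Set
    PiStrong P A =
      (∀ Q → Q ∈ A →
         ∃[ m ] ((m ≢ ℓ × ¬ InΠ P m × Q ∈ₗ m × Tangent A m)
           × (∀ m′ → m′ ≢ ℓ → ¬ InΠ P m′ → Q ∈ₗ m′ → Tangent A m′ → m′ ≡ m)))
      × (∀ m → InΠ P m → ¬ ContainsAffineLine A m)

    InW : Point → PointSet → Set
    InW P A = AffineBlockingSet A × PiStrong P A

{-# OPTIONS --safe #-}
-- Write A for B with P removed.  A line through a point x of A that is tangent to B meets B
-- only in x, so it misses P and is tangent to A; conversely a tangent to A missing P is a
-- tangent to B.  Hence at the points of A the semioval condition on B is exactly condition
-- (j′) on A.  That ℓ is tangent to B at P says that A misses ℓ, and that it is the only
-- tangent at P says that every other line through P meets A.  A line of Π lies in B iff its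
-- affine part lies in A, and ℓ ⊄ B because the tangent outside Π at a point of A meets ℓ in
-- a point of B other than P.
-- The only geometry needed is that two distinct lines meet in exactly one point (found via
-- the cross product of their coordinate vectors).  Finiteness of the field is used only to
-- search for a second point of B on an affine line through P.
module Submission where

open import Defs
open import Level using (0ℓ)
open import Data.Nat using (ℕ)
open import Data.Empty using (⊥-elim)
open import Data.Bool using (true; false; _∨_) renaming (_≟_ to _≟ᵇ_)
open import Data.Bool.Properties
  using (∧-conicalˡ; ∧-zeroʳ; ∧-identityʳ; ∨-zeroʳ; ∨-identityʳ; ¬-not)
open import Data.Product using (Σ; ∃; ∃-syntax; _×_; _,_)
open import Data.Sum using (inj₁; inj₂)
open import Data.Fin.Properties using (any?)
open import Function using (_∘_)
open import Function.Bundles using (Inverse)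
open import Relation.Binary using (DecidableEquality)
open import Relation.Nullary using (¬_; Dec; yes; no; does; contradiction)
open import Relation.Nullary.Decidable
  using (map′; _⊎-dec_; _×-dec_; ¬?; dec-true; dec-false; decidable-stable)
open import Relation.Binary.PropositionalEquality
  using (_≡_; _≢_; refl; sym; trans; cong; cong₂; subst; module ≡-Reasoning)
open import Algebra.Bundles using (CommutativeRing)

module Coordinates {q : ℕ} (F : FiniteField q) where
  open FiniteField F using (Carrier; 0#; 1#; 0≢1; inverse; _≟_; isCommutativeRing)
  open Plane F using (pt₁; pt₂; pt₃; coords)

  commutativeRing : CommutativeRing 0ℓ 0ℓ
  commutativeRing = record { isCommutativeRing = isCommutativeRing }

  open CommutativeRing commutativeRing
    using (_+_; _*_; -_; _-_; *-comm; *-identityˡ; *-identityʳ; zeroˡ; zeroʳ;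
           +-identityʳ; -‿inverseʳ)
  open import Algebra.Properties.Ring (CommutativeRing.ring commutativeRing)
    using (x[y-z]≈xy-xz; +-cancelʳ; x≈y⇒x∙y⁻¹≈ε; x∙y⁻¹≈ε⇒x≈y; -‿+-comm)
  open import Algebra.Properties.CommutativeSemigroup
    (CommutativeRing.*-commutativeSemigroup commutativeRing) using (x∙yz≈y∙xz)
  open import Algebra.Solver.Ring.NaturalCoefficients.Default
    (CommutativeRing.commutativeSemiring commutativeRing) using (solve; _:=_; _:+_; _:*_)
  open ≡-Reasoning

  Vec3 : Set
  Vec3 = Carrier × Carrier × Carrier

  IsZero : Vec3 → Set
  IsZero (w₁ , w₂ , w₃) = w₁ ≡ 0# × w₂ ≡ 0# × w₃ ≡ 0#

  infix 7 _·_
  infixr 8 _∙_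
  infix 8 _⨯_
  infix 4 _∥_

  _·_ : Vec3 → Vec3 → Carrier
  (u₁ , u₂ , u₃) · (v₁ , v₂ , v₃) = u₁ * v₁ + u₂ * v₂ + u₃ * v₃

  _∙_ : Carrier → Vec3 → Vec3
  c ∙ (w₁ , w₂ , w₃) = c * w₁ , c * w₂ , c * w₃

  _⨯_ : Vec3 → Vec3 → Vec3
  (u₁ , u₂ , u₃) ⨯ (v₁ , v₂ , v₃) =
    u₂ * v₃ - u₃ * v₂ , u₃ * v₁ - u₁ * v₃ , u₁ * v₂ - u₂ * v₁

  _∥_ : Vec3 → Vec3 → Set
  (u₁ , u₂ , u₃) ∥ (v₁ , v₂ , v₃) =
    u₂ * v₃ ≡ u₃ * v₂ × u₃ * v₁ ≡ u₁ * v₃ × u₁ * v₂ ≡ u₂ * v₁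

  -- The solver only knows commutative semirings, so negated terms enter it as atoms.
  a+d≡c+b⇒a-b≡c-d : ∀ {a b c d} → a + d ≡ c + b → a - b ≡ c - d
  a+d≡c+b⇒a-b≡c-d {a} {b} {c} {d} a+d≡c+b = begin
    a - b              ≡⟨ sym (+-identityʳ (a - b)) ⟩
    a - b + 0#         ≡⟨ cong (a - b +_) (sym (-‿inverseʳ d)) ⟩
    a - b + (d - d)    ≡⟨ solve 4 (λ a d nb nd → a :+ nb :+ (d :+ nd) := a :+ d :+ (nb :+ nd))
                                refl a d (- b) (- d) ⟩
    a + d + (- b - d)  ≡⟨ cong (_+ (- b - d)) a+d≡c+b ⟩
    c + b + (- b - d)  ≡⟨ solve 4 (λ c b nb nd → c :+ b :+ (nb :+ nd) := c :+ nd :+ (b :+ nb))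
                                refl c b (- b) (- d) ⟩
    c - d + (b - b)    ≡⟨ cong (c - d +_) (-‿inverseʳ b) ⟩
    c - d + 0#         ≡⟨ +-identityʳ (c - d) ⟩
    c - d              ∎

  ·-distrib-diffʳ : ∀ u₁ u₂ u₃ p₁ p₂ p₃ n₁ n₂ n₃ →
    (u₁ , u₂ , u₃) · (p₁ - n₁ , p₂ - n₂ , p₃ - n₃)
      ≡ (u₁ , u₂ , u₃) · (p₁ , p₂ , p₃) - (u₁ , u₂ , u₃) · (n₁ , n₂ , n₃)
  ·-distrib-diffʳ u₁ u₂ u₃ p₁ p₂ p₃ n₁ n₂ n₃ = begin
    u₁ * (p₁ - n₁) + u₂ * (p₂ - n₂) + u₃ * (p₃ - n₃)
      ≡⟨ cong₂ _+_ (cong₂ _+_ (x[y-z]≈xy-xz u₁ p₁ n₁) (x[y-z]≈xy-xz u₂ p₂ n₂))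
                   (x[y-z]≈xy-xz u₃ p₃ n₃) ⟩
    (a - b) + (c - d) + (e - f)
      ≡⟨ solve 6 (λ a c e nb nd nf →
             a :+ nb :+ (c :+ nd) :+ (e :+ nf) := a :+ c :+ e :+ (nb :+ nd :+ nf))
           refl a c e (- b) (- d) (- f) ⟩
    a + c + e + (- b - d - f)
      ≡⟨ cong (a + c + e +_) (trans (cong (_- f) (-‿+-comm b d)) (-‿+-comm (b + d) f)) ⟩
    a + c + e - (b + d + f) ∎
    where
    a b c d e f : Carrier
    a = u₁ * p₁ ; b = u₁ * n₁ ; c = u₂ * p₂ ; d = u₂ * n₂ ; e = u₃ * p₃ ; f = u₃ * n₃

  ·-⨯-selfˡ : ∀ u v → u · (u ⨯ v) ≡ 0#
  ·-⨯-selfˡ (u₁ , u₂ , u₃) (v₁ , v₂ , v₃) =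
    trans (·-distrib-diffʳ u₁ u₂ u₃ _ _ _ _ _ _) (x≈y⇒x∙y⁻¹≈ε
      (solve 6 (λ u₁ u₂ u₃ v₁ v₂ v₃ →
          u₁ :* (u₂ :* v₃) :+ u₂ :* (u₃ :* v₁) :+ u₃ :* (u₁ :* v₂)
       := u₁ :* (u₃ :* v₂) :+ u₂ :* (u₁ :* v₃) :+ u₃ :* (u₂ :* v₁)) refl u₁ u₂ u₃ v₁ v₂ v₃))

  ·-⨯-selfʳ : ∀ u v → v · (u ⨯ v) ≡ 0#
  ·-⨯-selfʳ (u₁ , u₂ , u₃) (v₁ , v₂ , v₃) =
    trans (·-distrib-diffʳ v₁ v₂ v₃ _ _ _ _ _ _) (x≈y⇒x∙y⁻¹≈ε
      (solve 6 (λ u₁ u₂ u₃ v₁ v₂ v₃ →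
          v₁ :* (u₂ :* v₃) :+ v₂ :* (u₃ :* v₁) :+ v₃ :* (u₁ :* v₂)
       := v₁ :* (u₃ :* v₂) :+ v₂ :* (u₁ :* v₃) :+ v₃ :* (u₂ :* v₁)) refl u₁ u₂ u₃ v₁ v₂ v₃))

  ·≡0-rotate : ∀ {u₁ u₂ u₃ v₁ v₂ v₃} →
    (u₁ , u₂ , u₃) · (v₁ , v₂ , v₃) ≡ 0# → (u₂ , u₃ , u₁) · (v₂ , v₃ , v₁) ≡ 0#
  ·≡0-rotate {u₁} {u₂} {u₃} {v₁} {v₂} {v₃} = trans (solve 6 (λ u₁ u₂ u₃ v₁ v₂ v₃ →
    u₂ :* v₂ :+ u₃ :* v₃ :+ u₁ :* v₁ := u₁ :* v₁ :+ u₂ :* v₂ :+ u₃ :* v₃) refl u₁ u₂ u₃ v₁ v₂ v₃)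

  ∥-⨯-component : ∀ x₁ x₂ x₃ L₁ L₂ L₃ M₁ M₂ M₃ →
    (L₁ , L₂ , L₃) · (x₁ , x₂ , x₃) ≡ 0# → (M₁ , M₂ , M₃) · (x₁ , x₂ , x₃) ≡ 0# →
    x₂ * (L₁ * M₂ - L₂ * M₁) ≡ x₃ * (L₃ * M₁ - L₁ * M₃)
  ∥-⨯-component x₁ x₂ x₃ L₁ L₂ L₃ M₁ M₂ M₃ L·x≡0 M·x≡0 = begin
    x₂ * (L₁ * M₂ - L₂ * M₁)         ≡⟨ x[y-z]≈xy-xz x₂ _ _ ⟩
    x₂ * (L₁ * M₂) - x₂ * (L₂ * M₁)  ≡⟨ a+d≡c+b⇒a-b≡c-d cross-terms ⟩
    x₃ * (L₃ * M₁) - x₃ * (L₁ * M₃)  ≡⟨ sym (x[y-z]≈xy-xz x₃ _ _) ⟩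
    x₃ * (L₃ * M₁ - L₁ * M₃)         ∎
    where
    lhs : x₂ * (L₁ * M₂) + x₃ * (L₁ * M₃) + x₁ * (L₁ * M₁) ≡ 0#
    lhs = begin
      x₂ * (L₁ * M₂) + x₃ * (L₁ * M₃) + x₁ * (L₁ * M₁)
        ≡⟨ solve 7 (λ x₁ x₂ x₃ L₁ M₁ M₂ M₃ →
             x₂ :* (L₁ :* M₂) :+ x₃ :* (L₁ :* M₃) :+ x₁ :* (L₁ :* M₁)
          := L₁ :* (M₁ :* x₁ :+ M₂ :* x₂ :+ M₃ :* x₃)) refl x₁ x₂ x₃ L₁ M₁ M₂ M₃ ⟩
      L₁ * (M₁ * x₁ + M₂ * x₂ + M₃ * x₃)  ≡⟨ cong (L₁ *_) M·x≡0 ⟩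
      L₁ * 0#                              ≡⟨ zeroʳ L₁ ⟩
      0#                                   ∎
    rhs : x₃ * (L₃ * M₁) + x₂ * (L₂ * M₁) + x₁ * (L₁ * M₁) ≡ 0#
    rhs = begin
      x₃ * (L₃ * M₁) + x₂ * (L₂ * M₁) + x₁ * (L₁ * M₁)
        ≡⟨ solve 7 (λ x₁ x₂ x₃ L₁ L₂ L₃ M₁ →
             x₃ :* (L₃ :* M₁) :+ x₂ :* (L₂ :* M₁) :+ x₁ :* (L₁ :* M₁)
          := M₁ :* (L₁ :* x₁ :+ L₂ :* x₂ :+ L₃ :* x₃)) refl x₁ x₂ x₃ L₁ L₂ L₃ M₁ ⟩
      M₁ * (L₁ * x₁ + L₂ * x₂ + L₃ * x₃)  ≡⟨ cong (M₁ *_) L·x≡0 ⟩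
      M₁ * 0#                              ≡⟨ zeroʳ M₁ ⟩
      0#                                   ∎
    -- Adding x₁ L₁ M₁ to both sides turns them into L₁ (M · x) and M₁ (L · x), which vanish.
    cross-terms : x₂ * (L₁ * M₂) + x₃ * (L₁ * M₃) ≡ x₃ * (L₃ * M₁) + x₂ * (L₂ * M₁)
    cross-terms = +-cancelʳ (x₁ * (L₁ * M₁)) _ _ (trans lhs (sym rhs))

  common-zero⇒∥-⨯ : ∀ x L M → L · x ≡ 0# → M · x ≡ 0# → x ∥ L ⨯ M
  common-zero⇒∥-⨯ (x₁ , x₂ , x₃) (L₁ , L₂ , L₃) (M₁ , M₂ , M₃) L·x≡0 M·x≡0 =
      ∥-⨯-component x₁ x₂ x₃ L₁ L₂ L₃ M₁ M₂ M₃ L·x≡0 M·x≡0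
    , ∥-⨯-component x₂ x₃ x₁ L₂ L₃ L₁ M₂ M₃ M₁ (·≡0-rotate L·x≡0) (·≡0-rotate M·x≡0)
    , ∥-⨯-component x₃ x₁ x₂ L₃ L₁ L₂ M₃ M₁ M₂
        (·≡0-rotate (·≡0-rotate L·x≡0)) (·≡0-rotate (·≡0-rotate M·x≡0))

  ⨯-zero⇒∥ : ∀ u v → IsZero (u ⨯ v) → u ∥ v
  ⨯-zero⇒∥ (u₁ , u₂ , u₃) (v₁ , v₂ , v₃) (e₁ , e₂ , e₃) =
    x∙y⁻¹≈ε⇒x≈y _ _ e₁ , x∙y⁻¹≈ε⇒x≈y _ _ e₂ , x∙y⁻¹≈ε⇒x≈y _ _ e₃

  ·-∙ʳ : ∀ u c w → u · (c ∙ w) ≡ c * (u · w)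
  ·-∙ʳ (u₁ , u₂ , u₃) c (w₁ , w₂ , w₃) = solve 7 (λ u₁ u₂ u₃ c w₁ w₂ w₃ →
      u₁ :* (c :* w₁) :+ u₂ :* (c :* w₂) :+ u₃ :* (c :* w₃)
   := c :* (u₁ :* w₁ :+ u₂ :* w₂ :+ u₃ :* w₃)) refl u₁ u₂ u₃ c w₁ w₂ w₃

  ∥-∙ʳ : ∀ u c w → u ∥ w → u ∥ c ∙ w
  ∥-∙ʳ (u₁ , u₂ , u₃) c (w₁ , w₂ , w₃) (e₁ , e₂ , e₃) = scaled e₁ , scaled e₂ , scaled e₃
    where
    scaled : ∀ {a b d e} → a * b ≡ d * e → a * (c * b) ≡ d * (c * e)
    scaled {a} {b} {d} {e} ab≡de = begin
      a * (c * b)  ≡⟨ x∙yz≈y∙xz a c b ⟩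
      c * (a * b)  ≡⟨ cong (c *_) ab≡de ⟩
      c * (d * e)  ≡⟨ x∙yz≈y∙xz c d e ⟩
      d * (c * e)  ∎

  nonzero⇒unit-multiple : ∀ {w} → w ≢ 0# → ∃[ c ] 1# ≡ c * w
  nonzero⇒unit-multiple {w} w≢0 =
    let c , wc≡1 = inverse w w≢0 in c , sym (trans (*-comm c w) wc≡1)

  zero-multiple : ∀ c {w} → w ≡ 0# → 0# ≡ c * w
  zero-multiple c refl = sym (zeroʳ c)

  ·-multiple-zero : ∀ u {v c w} → v ≡ c ∙ w → u · w ≡ 0# → u · v ≡ 0#
  ·-multiple-zero u {c = c} {w} refl u·w≡0 = begin
    u · (c ∙ w)  ≡⟨ ·-∙ʳ u c w ⟩
    c * (u · w)  ≡⟨ cong (c *_) u·w≡0 ⟩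
    c * 0#       ≡⟨ zeroʳ c ⟩
    0#           ∎

  normalise : ∀ w → ¬ IsZero w → ∃[ x ] ∃[ c ] coords x ≡ c ∙ w
  normalise (w₁ , w₂ , w₃) w≢0 with w₁ ≟ 0# | w₂ ≟ 0# | w₃ ≟ 0#
  ... | no w₁≢0 | _ | _ =
    let c , 1≡cw₁ = nonzero⇒unit-multiple w₁≢0 in
    pt₁ (c * w₂) (c * w₃) , c , cong (_, c * w₂ , c * w₃) 1≡cw₁
  ... | yes w₁≡0 | no w₂≢0 | _ =
    let c , 1≡cw₂ = nonzero⇒unit-multiple w₂≢0 in
    pt₂ (c * w₃) , c , cong₂ _,_ (zero-multiple c w₁≡0) (cong (_, c * w₃) 1≡cw₂)
  ... | yes w₁≡0 | yes w₂≡0 | no w₃≢0 =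
    let c , 1≡cw₃ = nonzero⇒unit-multiple w₃≢0 in
    pt₃ , c , cong₂ _,_ (zero-multiple c w₁≡0) (cong₂ _,_ (zero-multiple c w₂≡0) 1≡cw₃)
  ... | yes w₁≡0 | yes w₂≡0 | yes w₃≡0 = ⊥-elim (w≢0 (w₁≡0 , w₂≡0 , w₃≡0))

  unit-cancel : ∀ {a b} → a * 1# ≡ 1# * b → a ≡ b
  unit-cancel {a} {b} e = trans (sym (*-identityʳ a)) (trans e (*-identityˡ b))

  1·1≢·0 : ∀ a → 1# * 1# ≢ a * 0#
  1·1≢·0 a e = 0≢1 (trans (sym (zeroʳ a)) (trans (sym e) (*-identityˡ 1#)))

  1·1≢0· : ∀ a → 1# * 1# ≢ 0# * a
  1·1≢0· a e = 0≢1 (trans (sym (zeroˡ a)) (trans (sym e) (*-identityˡ 1#)))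

  coords-∥⇒≡ : ∀ x y → coords x ∥ coords y → x ≡ y
  coords-∥⇒≡ (pt₁ a b) (pt₁ c d) (_ , b≡d , c≡a) =
    cong₂ pt₁ (unit-cancel (sym c≡a)) (unit-cancel b≡d)
  coords-∥⇒≡ (pt₂ a) (pt₂ c) (c≡a , _) = cong pt₂ (unit-cancel (sym c≡a))
  coords-∥⇒≡ pt₃ pt₃ _ = refl
  coords-∥⇒≡ (pt₁ a b) (pt₂ c) (_ , _ , e) = ⊥-elim (1·1≢·0 a e)
  coords-∥⇒≡ (pt₁ a b) pt₃ (_ , e , _) = ⊥-elim (1·1≢·0 b (sym e))
  coords-∥⇒≡ (pt₂ a) (pt₁ c d) (_ , _ , e) = ⊥-elim (1·1≢0· c (sym e))
  coords-∥⇒≡ (pt₂ a) pt₃ (e , _) = ⊥-elim (1·1≢·0 a e)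
  coords-∥⇒≡ pt₃ (pt₁ c d) (_ , e , _) = ⊥-elim (1·1≢0· d e)
  coords-∥⇒≡ pt₃ (pt₂ c) (e , _) = ⊥-elim (1·1≢0· c (sym e))

module Incidence {q : ℕ} (F : FiniteField q) where
  open FiniteField F using (Carrier; 0#; _≟_; size)
  open Plane F
  open Coordinates F

  infix 4 _∈ₗ?_ _≟ₗ_

  _∈ₗ?_ : ∀ x L → Dec (x ∈ₗ L)
  x ∈ₗ? L = (lcoords L · coords x) ≟ 0#

  dual : Line → Point
  dual (ln₁ a b) = pt₁ a b
  dual (ln₂ a) = pt₂ a
  dual ln₃ = pt₃

  coords-dual : ∀ L → coords (dual L) ≡ lcoords L
  coords-dual (ln₁ a b) = refl
  coords-dual (ln₂ a) = refl
  coords-dual ln₃ = refl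

  dual-injective : ∀ {L M} → dual L ≡ dual M → L ≡ M
  dual-injective {ln₁ a b} {ln₁ .a .b} refl = refl
  dual-injective {ln₂ a} {ln₂ .a} refl = refl
  dual-injective {ln₃} {ln₃} refl = refl
  dual-injective {ln₁ _ _} {ln₂ _} ()
  dual-injective {ln₁ _ _} {ln₃} ()
  dual-injective {ln₂ _} {ln₁ _ _} ()
  dual-injective {ln₂ _} {ln₃} ()
  dual-injective {ln₃} {ln₁ _ _} ()
  dual-injective {ln₃} {ln₂ _} ()

  _≟ₗ_ : DecidableEquality Line
  L ≟ₗ M = map′ dual-injective (cong dual) (dual L ≟ₚ dual M)

  another-line : ∀ (ℓ : Line) → ∃[ m ] m ≢ ℓ
  another-line (ln₁ _ _) = ln₃ , λ ()
  another-line (ln₂ _) = ln₃ , λ ()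
  another-line ln₃ = ln₂ 0# , λ ()

  ⨯-nonzero : ∀ {L M} → L ≢ M → ¬ IsZero (lcoords L ⨯ lcoords M)
  ⨯-nonzero {L} {M} L≢M L⨯M≡0 =
    L≢M (dual-injective (coords-∥⇒≡ (dual L) (dual M) dual-L∥dual-M))
    where
    dual-L∥dual-M : coords (dual L) ∥ coords (dual M)
    dual-L∥dual-M rewrite coords-dual L | coords-dual M = ⨯-zero⇒∥ (lcoords L) (lcoords M) L⨯M≡0

  lines-meet : ∀ {L M} → L ≢ M → ∃[ x ] (x ∈ₗ L × x ∈ₗ M)
  lines-meet {L} {M} L≢M with normalise (lcoords L ⨯ lcoords M) (⨯-nonzero L≢M)
  ... | x , _ , x≡c∙w =
    x , ·-multiple-zero (lcoords L) x≡c∙w (·-⨯-selfˡ (lcoords L) (lcoords M))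
      , ·-multiple-zero (lcoords M) x≡c∙w (·-⨯-selfʳ (lcoords L) (lcoords M))

  lines-meet-once : ∀ {L M} → L ≢ M → ∀ {x y} → x ∈ₗ L → x ∈ₗ M → y ∈ₗ L → y ∈ₗ M → x ≡ y
  lines-meet-once {L} {M} L≢M x∈L x∈M y∈L y∈M
    with normalise (lcoords L ⨯ lcoords M) (⨯-nonzero L≢M)
  ... | n , c , n≡c∙w = trans (≡n x∈L x∈M) (sym (≡n y∈L y∈M))
    where
    ≡n : ∀ {z} → z ∈ₗ L → z ∈ₗ M → z ≡ n
    ≡n {z} z∈L z∈M = coords-∥⇒≡ z n (subst (coords z ∥_) (sym n≡c∙w)
      (∥-∙ʳ (coords z) c _ (common-zero⇒∥-⨯ (coords z) (lcoords L) (lcoords M) z∈L z∈M)))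

  any?ᶜ : {Q : Carrier → Set} → (∀ c → Dec (Q c)) → Dec (∃ Q)
  any?ᶜ {Q} Q? = map′
    (λ (i , h) → from i , h)
    (λ (c , h) → to c , subst Q (sym (strictlyInverseʳ c)) h)
    (any? (Q? ∘ from))
    where open Inverse size

  any?ₚ : {Q : Point → Set} → (∀ x → Dec (Q x)) → Dec (∃ Q)
  any?ₚ Q? = map′
    (λ { (inj₁ (a , b , h)) → pt₁ a b , h
       ; (inj₂ (inj₁ (a , h))) → pt₂ a , h
       ; (inj₂ (inj₂ h)) → pt₃ , h })
    (λ { (pt₁ a b , h) → inj₁ (a , b , h)
       ; (pt₂ a , h) → inj₂ (inj₁ (a , h))
       ; (pt₃ , h) → inj₂ (inj₂ h) })
    (any?ᶜ (λ a → any?ᶜ (λ b → Q? (pt₁ a b))) ⊎-dec any?ᶜ (λ a → Q? (pt₂ a)) ⊎-dec Q? pt₃)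

module Punctures {q : ℕ} (F : FiniteField q) where
  open Plane F
  open Incidence F

  tangent-unique : ∀ {K} L {x y} → Tangent K L → x ∈ K → x ∈ₗ L → y ∈ K → y ∈ₗ L → y ≡ x
  tangent-unique _ (_ , _ , _ , ≡z) x∈K x∈L y∈K y∈L = trans (≡z _ y∈K y∈L) (sym (≡z _ x∈K x∈L))

  _∪｛_｝ : PointSet → Point → PointSet
  (K ∪｛ P ｝) x = K x ∨ does (x ≟ₚ P)

  -- Both B ∖｛ P ｝ inside B (for P ∈ B) and A inside A ∪｛ P ｝ (for P ∉ A) are punctures,
  -- so the lemmas of Correspondence serve both directions of the theorem.
  record Puncture (B : PointSet) (P : Point) (A : PointSet) : Set where
    field
      P∈B : P ∈ B
      A⊆B : ∀ {x} → x ∈ A → x ∈ B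
      A∌P : ∀ {x} → x ∈ A → x ≢ P
      B∖P⊆A : ∀ {x} → x ∈ B → x ≢ P → x ∈ A

  ∖-puncture : ∀ {B P} → P ∈ B → Puncture B P (B ∖｛ P ｝)
  ∖-puncture {B} {P} P∈B = record
    { P∈B = P∈B
    ; A⊆B = λ {x} → ∧-conicalˡ (B x) _
    ; A∌P = ∈∖⇒≢
    ; B∖P⊆A = ∈∖
    }
    where
    ∈∖⇒≢ : ∀ {x} → x ∈ (B ∖｛ P ｝) → x ≢ P
    ∈∖⇒≢ {x} x∈B∖P with x ≟ₚ P
    ... | yes _ = contradiction (trans (sym (∧-zeroʳ (B x))) x∈B∖P) λ ()
    ... | no x≢P = x≢P
    ∈∖ : ∀ {x} → x ∈ B → x ≢ P → x ∈ (B ∖｛ P ｝)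
    ∈∖ {x} x∈B x≢P rewrite x∈B | dec-false (x ≟ₚ P) x≢P = refl

  ∪-puncture : ∀ {A P} → ¬ P ∈ A → Puncture (A ∪｛ P ｝) P A
  ∪-puncture {A} {P} P∉A = record
    { P∈B = subst (λ b → A P ∨ b ≡ true) (sym (dec-true (P ≟ₚ P) refl)) (∨-zeroʳ (A P))
    ; A⊆B = λ {x} x∈A → subst (λ b → b ∨ does (x ≟ₚ P) ≡ true) (sym x∈A) refl
    ; A∌P = λ { x∈A refl → P∉A x∈A }
    ; B∖P⊆A = λ {x} x∈B x≢P →
        trans (sym (∨-identityʳ (A x))) (subst (λ b → A x ∨ b ≡ true) (dec-false (x ≟ₚ P) x≢P) x∈B)
    }

  ∪-∖-cancel : ∀ {A P} → ¬ P ∈ A → ∀ x → A x ≡ ((A ∪｛ P ｝) ∖｛ P ｝) x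
  ∪-∖-cancel {A} {P} P∉A x with x ≟ₚ P
  ... | yes refl = trans (¬-not P∉A) (sym (∧-zeroʳ (A P ∨ true)))
  ... | no _ = sym (trans (∧-identityʳ (A x ∨ false)) (∨-identityʳ (A x)))

  UniqueTangentThrough : PointSet → Point → Set
  UniqueTangentThrough K x =
    ∃[ L ] (x ∈ₗ L × Tangent K L × (∀ L′ → x ∈ₗ L′ → Tangent K L′ → L′ ≡ L))

  module Correspondence
    (ℓ : Line) (P : Point) (P∈ℓ : P ∈ₗ ℓ) {B A : PointSet} (π : Puncture B P A) where
    open Affine ℓ
    open Puncture π

    UniqueTangentOutsideΠ : PointSet → Point → Set
    UniqueTangentOutsideΠ K x = ∃[ m ] ((m ≢ ℓ × ¬ InΠ P m × x ∈ₗ m × Tangent K m)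
      × (∀ m′ → m′ ≢ ℓ → ¬ InΠ P m′ → x ∈ₗ m′ → Tangent K m′ → m′ ≡ m))

    tangentℓ⇒affine : Tangent B ℓ → AffineSet A
    tangentℓ⇒affine tangentℓ x x∈A x∈ℓ =
      A∌P x∈A (tangent-unique ℓ tangentℓ P∈B P∈ℓ (A⊆B x∈A) x∈ℓ)

    affine⇒tangentℓ : AffineSet A → Tangent B ℓ
    affine⇒tangentℓ affine = P , P∈B , P∈ℓ , λ y y∈B y∈ℓ →
      decidable-stable (y ≟ₚ P) (λ y≢P → affine y (B∖P⊆A y∈B y≢P) y∈ℓ)

    affine⇒≢ℓ : AffineSet A → ∀ L {x} → x ∈ A → x ∈ₗ L → L ≢ ℓ
    affine⇒≢ℓ affine _ x∈A x∈L refl = affine _ x∈A x∈L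

    tangent-through-A-avoids-P : ∀ L {x} → x ∈ A → x ∈ₗ L → Tangent B L → ¬ P ∈ₗ L
    tangent-through-A-avoids-P L x∈A x∈L tangent P∈L =
      A∌P x∈A (tangent-unique L tangent P∈B P∈L (A⊆B x∈A) x∈L)

    tangent-restrict : ∀ L {x} → x ∈ A → x ∈ₗ L → Tangent B L → Tangent A L
    tangent-restrict L x∈A x∈L tangent =
      _ , x∈A , x∈L , λ y y∈A y∈L → tangent-unique L tangent (A⊆B x∈A) x∈L (A⊆B y∈A) y∈L

    tangent-extend : ∀ L → ¬ P ∈ₗ L → Tangent A L → Tangent B L
    tangent-extend L P∉L (z , z∈A , z∈L , ≡z) =
      z , A⊆B z∈A , z∈L , λ y y∈B y∈L → ≡z y (B∖P⊆A y∈B λ { refl → P∉L y∈L }) y∈L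

    semioval-at⇒Π-strong-at : ∀ {x} → AffineSet A → x ∈ A →
      UniqueTangentThrough B x → UniqueTangentOutsideΠ A x
    semioval-at⇒Π-strong-at affine x∈A (L , x∈L , tangent , unique) =
        L , ( affine⇒≢ℓ affine L x∈A x∈L
            , (λ (_ , P∈L) → tangent-through-A-avoids-P L x∈A x∈L tangent P∈L)
            , x∈L , tangent-restrict L x∈A x∈L tangent )
      , λ m m≢ℓ m∉Π x∈m tangent′ →
          unique m x∈m (tangent-extend m (λ P∈m → m∉Π (m≢ℓ , P∈m)) tangent′)

    Π-strong-at⇒semioval-at : ∀ {x} → AffineSet A → x ∈ A →
      UniqueTangentOutsideΠ A x → UniqueTangentThrough B x
    Π-strong-at⇒semioval-at affine x∈A (m , (m≢ℓ , m∉Π , x∈m , tangent) , unique) =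
        m , x∈m , tangent-extend m (λ P∈m → m∉Π (m≢ℓ , P∈m)) tangent
      , λ L x∈L tangent′ → unique L (affine⇒≢ℓ affine L x∈A x∈L)
          (λ (_ , P∈L) → tangent-through-A-avoids-P L x∈A x∈L tangent′ P∈L)
          x∈L (tangent-restrict L x∈A x∈L tangent′)

    contains-affine⇒contains : ∀ m → m ≢ ℓ → P ∈ₗ m → ContainsAffineLine A m → ContainsLine B m
    contains-affine⇒contains m m≢ℓ P∈m contains x x∈m with x ∈ₗ? ℓ
    ... | yes x∈ℓ = subst (_∈ B) (lines-meet-once m≢ℓ P∈m P∈ℓ x∈m x∈ℓ) P∈B
    ... | no x∉ℓ = A⊆B (contains x x∈m x∉ℓ)

    contains⇒contains-affine : ∀ m → ContainsLine B m → ContainsAffineLine A m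
    contains⇒contains-affine m contains x x∈m x∉ℓ = B∖P⊆A (contains x x∈m) λ { refl → x∉ℓ P∈ℓ }

    meets⇒meets-affine : (∀ L → P ∈ₗ L → Tangent B L → L ≡ ℓ) →
      ∀ m → m ≢ ℓ → Meets B m → Meets A m
    meets⇒meets-affine ℓ-only m m≢ℓ (x , x∈B , x∈m) with x ≟ₚ P
    ... | no x≢P = x , B∖P⊆A x∈B x≢P , x∈m
    ... | yes refl with any?ₚ (λ y → (B y ≟ᵇ true) ×-dec y ∈ₗ? m ×-dec ¬? (y ≟ₚ P))
    ...   | yes (y , y∈B , y∈m , y≢P) = y , B∖P⊆A y∈B y≢P , y∈m
    ...   | no none = contradiction (ℓ-only m x∈m (P , x∈B , x∈m , λ y y∈B y∈m →
              decidable-stable (y ≟ₚ P) (λ y≢P → none (y , y∈B , y∈m , y≢P)))) m≢ℓ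

    tangent-at-P⇒ℓ : (∀ m → m ≢ ℓ → Meets A m) → ∀ L → P ∈ₗ L → Tangent B L → L ≡ ℓ
    tangent-at-P⇒ℓ meets L P∈L tangent with L ≟ₗ ℓ
    ... | yes L≡ℓ = L≡ℓ
    ... | no L≢ℓ = let y , y∈A , y∈L = meets L L≢ℓ in
      ⊥-elim (tangent-through-A-avoids-P L y∈A y∈L tangent P∈L)

    meets-affine⇒meets : (∀ m → m ≢ ℓ → Meets A m) → ∀ L → Meets B L
    meets-affine⇒meets meets L with L ≟ₗ ℓ
    ... | yes refl = P , P∈B , P∈ℓ
    ... | no L≢ℓ = let y , y∈A , y∈L = meets L L≢ℓ in y , A⊆B y∈A , y∈L

    L∩ℓ⊆B⇒P∈L : AffineSet A → ∀ L → L ≢ ℓ → (∀ R → R ∈ₗ L → R ∈ₗ ℓ → R ∈ B) → P ∈ₗ L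
    L∩ℓ⊆B⇒P∈L affine L L≢ℓ L∩ℓ⊆B =
      let R , R∈L , R∈ℓ = lines-meet L≢ℓ
      in subst (_∈ₗ L)
           (tangent-unique ℓ (affine⇒tangentℓ affine) P∈B P∈ℓ (L∩ℓ⊆B R R∈L R∈ℓ) R∈ℓ) R∈L

    InW⇒¬ContainsLine : InW P A → ∀ L → ¬ ContainsLine B L
    InW⇒¬ContainsLine ((affine , meets) , strong , no-Π-line) L contains with L ≟ₗ ℓ
    ... | no L≢ℓ = no-Π-line L (L≢ℓ , L∩ℓ⊆B⇒P∈L affine L L≢ℓ (λ R R∈L _ → contains R R∈L))
                    (contains⇒contains-affine L contains)
    ... | yes refl =
      let m₀ , m₀≢ℓ = another-line ℓ
          Q , Q∈A , _ = meets m₀ m₀≢ℓ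
          m , (m≢ℓ , m∉Π , _) , _ = strong Q Q∈A
      in m∉Π (m≢ℓ , L∩ℓ⊆B⇒P∈L affine m m≢ℓ (λ R _ R∈ℓ → contains R R∈ℓ))

    Z⇒W : InZ P ℓ B → InW P A
    Z⇒W (((meets , no-line) , semioval) , _ , tangentℓ , ℓ-only) =
        (affine , λ m m≢ℓ → meets⇒meets-affine ℓ-only m m≢ℓ (meets m))
      , (λ x x∈A → semioval-at⇒Π-strong-at affine x∈A (semioval x (A⊆B x∈A)))
      , λ m (m≢ℓ , P∈m) → no-line m ∘ contains-affine⇒contains m m≢ℓ P∈m
      where
      affine : AffineSet A
      affine = tangentℓ⇒affine tangentℓ

    W⇒Z : InW P A → InZ P ℓ B
    W⇒Z w@((affine , meets) , strong , _) =
        ((meets-affine⇒meets meets , InW⇒¬ContainsLine w) , semioval)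
      , P∈B , affine⇒tangentℓ affine , tangent-at-P⇒ℓ meets
      where
      semioval : Semioval B
      semioval x x∈B with x ≟ₚ P
      ... | yes refl = ℓ , P∈ℓ , affine⇒tangentℓ affine , tangent-at-P⇒ℓ meets
      ... | no x≢P = Π-strong-at⇒semioval-at affine (B∖P⊆A x∈B x≢P) (strong x (B∖P⊆A x∈B x≢P))

proposition4p15 : (q : ℕ) → PrimePower q → (F : FiniteField q)
    → let open Plane F in
      (ℓ : Line) → (P : Point) → P ∈ₗ ℓ
    → let open Affine ℓ in
      ((B : PointSet) → InZ P ℓ B → InW P (B ∖｛ P ｝))
      × ((A : PointSet) → InW P A
          → Σ PointSet (λ B → InZ P ℓ B × ((x : Point) → A x ≡ (B ∖｛ P ｝) x)))
proposition4p15 _ _ F ℓ P P∈ℓ =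
    (λ B z@(_ , P∈B , _) → Z⇒W (∖-puncture P∈B) z)
  , λ A w@((affine , _) , _) →
      let P∉A : ¬ P ∈ A
          P∉A P∈A = affine P P∈A P∈ℓ
      in A ∪｛ P ｝ , W⇒Z (∪-puncture P∉A) w , ∪-∖-cancel P∉A
  where
  open Plane F
  open Punctures F
  open Correspondence ℓ P P∈ℓ
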